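{- Let $w$ be a word and let $k\geq 0$. For any segment of $2^k$ consecutive indices $j$ of the array $\pi'_w$, at most $48$ different values from the interval $[2^k,2^{k+1})$ occur among the values $\pi'_w[j]$ for $j$ in that segment.
   Context: For a word $w$ of length $n$, a border of $w$ is a word that is both a prefix and a suffix; it is proper if shorter than $w$. $\pi_w[i]$ is the length of the longest proper border of $w[1\dots i]$. The strong failure function is $\pi'_w[n]=\pi_w[n]$, and for $1\le i<n$, $\pi'_w[i]$ is the length of the longest proper border $u$ of $w[1\dots i]$ such that $w[|u|+1]\neq w[i+1]$, or $-1$ if no such border exists. -}

module Defs where

open import Data.Nat using (ℕ; suc; _∸_; _<_; _≤_)
open import Data.Integer using (ℤ; +_; -[1+_])
open import Data.List using (List; length; take; drop; head; _++_)
open import Data.Maybe using (Maybe)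
open import Data.Product using (Σ; ∃; _×_)
open import Relation.Binary.PropositionalEquality using (_≡_; _≢_)
open import Relation.Nullary using (¬_)

-- words over an alphabet A are lists of letters; positions are 1-indexed

letter : {A : Set} → List A → ℕ → Maybe A
letter w p = head (drop (p ∸ 1) w)

pre : {A : Set} → List A → ℕ → List A
pre w i = take i w

IsBorder : {A : Set} → List A → List A → Set
IsBorder {A} u v = (Σ (List A) λ s → u ++ s ≡ v) × (Σ (List A) λ p → p ++ u ≡ v)

IsProperBorder : {A : Set} → List A → List A → Set
IsProperBorder u v = IsBorder u v × length u < length v

IsStrongBorder : {A : Set} → List A → ℕ → List A → Set
IsStrongBorder w i u = IsProperBorder u (pre w i) × letter w (suc (length u)) ≢ letter w (suc i)

-- StrongFail w i r  :  π'_w[i] = r   (for 1 ≤ i ≤ |w|)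
data StrongFail {A : Set} (w : List A) (i : ℕ) : ℤ → Set where
  -- i = n : π'_w[n] = π_w[n], the length of the longest proper border of w
  last   : ∀ u → i ≡ length w → IsProperBorder u (pre w i)
         → (∀ v → IsProperBorder v (pre w i) → length v ≤ length u)
         → StrongFail w i (+ length u)
  inner  : ∀ u → 1 ≤ i → i < length w → IsStrongBorder w i u
         → (∀ v → IsStrongBorder w i v → length v ≤ length u)
         → StrongFail w i (+ length u)
  none   : 1 ≤ i → i < length w → (∀ v → ¬ IsStrongBorder w i v)
         → StrongFail w i -[1+ 0 ]

module Submission where

-- Put L = 2^k.  A value v ∈ [L, 2L) taken by π'_w at a position
-- j ∈ [s, s + L) is a border length, so p = j − v is a period of w[0 .. j) and, unless
-- j = |w|, the letters w[v] and w[j] differ.  Call (v, p) a point.  Cut both ranges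
-- [L, 2L) (for v) and [s, s + L) (for j) into four quarters; this gives 16 cells.
--
-- For two points a, b with p_a ≤ p_b in the same cell, q = p_b − p_a is a short
-- period (2q < L) of the prefix of w of length M = min(j_a, j_b) − p_a, but not of the
-- prefix of length M + 1 ("q breaks at M"), and M ≥ L.  By a weak Fine–Wilf step two
-- short periods cannot break at different positions beyond q + q', so all pairs of
-- points in one cell break at the same M.  Among any three points of the cell the one
-- with least p then has v = M; four points would thus give two distinct values equal
-- to M.  Hence a cell holds at most 3 points, and there are at most 16 · 3 = 48 values.

open import Defs
open import Data.Nat hiding (_!)
open import Data.Nat.Properties
open import Data.Nat.DivMod using (_/_; _%_; m%n<n; m≡m%n+[m/n]*n; m/n*n≤m; m<n*o⇒m/o<n)
open import Data.Nat.Tactic.RingSolver using (solve-∀)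
import Data.Integer as ℤ
open import Data.List using (List; []; _∷_; length; take; drop; head; _++_; filter; map)
open import Data.List.Properties using (length-++; length-take; length-map)
open import Data.List.Membership.Propositional using (_∈_)
open import Data.List.Relation.Unary.Any using (here; there)
open import Data.List.Relation.Unary.All as All using (All; []; _∷_)
open import Data.List.Relation.Unary.All.Properties using (all-filter; filter⁺)
open import Data.List.Relation.Unary.AllPairs using (AllPairs; []; _∷_)
open import Data.List.Relation.Unary.AllPairs.Properties using (map⁻)
open import Data.List.Relation.Unary.Unique.Propositional using (Unique)
open import Data.List.Relation.Binary.Sublist.Propositional using (_⊆_; []; _∷_; _∷ʳ_; ⊆-trans)
open import Data.List.Relation.Binary.Sublist.Propositional.Properties using (All-resp-⊆; filter-⊆)
open import Data.Maybe using (Maybe)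
open import Data.Product using (Σ; _×_; _,_)
open import Data.Sum using (_⊎_; inj₁; inj₂)
open import Data.Empty using (⊥; ⊥-elim)
open import Relation.Nullary using (¬_; yes; no)
open import Relation.Unary using (Decidable)
open import Relation.Unary.Properties using (∁?)
open import Relation.Binary.Definitions using (tri<; tri≈; tri>)
open import Relation.Binary.PropositionalEquality

+-shuffle : ∀ x y z → x + y + z ≡ x + (z + y)
+-shuffle x y z = trans (+-assoc x y z) (cong (x +_) (+-comm y z))

-- xs ! i is the letter at 0-based position i; note that  letter w (suc i) = w ! i.
_!_ : {A : Set} → List A → ℕ → Maybe A
xs ! i = head (drop i xs)

!-take : {A : Set} (xs : List A) (j i : ℕ) → i < j → take j xs ! i ≡ xs ! i
!-take []       zero    i       _         = refl
!-take []       (suc j) i       _         = refl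
!-take (x ∷ xs) (suc j) zero    _         = refl
!-take (x ∷ xs) (suc j) (suc i) (s≤s i<j) = !-take xs j i i<j

!-++ˡ : {A : Set} (xs ys : List A) (i : ℕ) → i < length xs → (xs ++ ys) ! i ≡ xs ! i
!-++ˡ (x ∷ xs) ys zero    _         = refl
!-++ˡ (x ∷ xs) ys (suc i) (s≤s i<n) = !-++ˡ xs ys i i<n

!-++ʳ : {A : Set} (xs ys : List A) (i : ℕ) → (xs ++ ys) ! (length xs + i) ≡ ys ! i
!-++ʳ []       ys i = refl
!-++ʳ (x ∷ xs) ys i = !-++ʳ xs ys i

module Periodicity {A : Set} (w : List A) where

  Period : ℕ → ℕ → Set
  Period q M = ∀ i → i + q < M → w ! i ≡ w ! (i + q)

  Break : ℕ → ℕ → Set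
  Break q M = Period q M × ¬ Period q (suc M)

  period-mono : ∀ {q M M'} → M' ≤ M → Period q M → Period q M'
  period-mono M'≤M per i h = per i (≤-trans h M'≤M)

  -- The trivial period 0 never breaks, so a breaking period is positive.
  break-positive : ∀ {q M} → Break q M → 1 ≤ q
  break-positive {zero}  (_ , ¬per) = ⊥-elim (¬per λ i _ → cong (w !_) (sym (+-identityʳ i)))
  break-positive {suc q} _          = s≤s z≤n

  -- Weak Fine–Wilf step: if q is a period of w[0 .. M), q' ≥ 1 a period of w[0 .. M]
  -- and q + q' ≤ M, then q extends to w[0 .. M], via  w[M−q] = w[M−q−q'] = w[M−q'] = w[M].
  period-extend : ∀ {q q' M} → Period q M → Period q' (suc M) → 1 ≤ q' → q + q' ≤ M
                → Period q (suc M)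
  period-extend {q} {q'} {M} per per' 1≤q' q+q'≤M i i+q<1+M
    with m≤n⇒m<n∨m≡n (≤-pred i+q<1+M)
  ... | inj₁ i+q<M = per i i+q<M
  ... | inj₂ i+q≡M = begin
      w ! i             ≡⟨ cong (w !_) (sym t+q'≡i) ⟩
      w ! (t + q')      ≡⟨ sym (per' t (s≤s (≤-trans (≤-reflexive t+q'≡i) i≤M))) ⟩
      w ! t             ≡⟨ per t t+q<M ⟩
      w ! (t + q)       ≡⟨ per' (t + q) (s≤s (≤-reflexive t+q+q'≡M)) ⟩
      w ! (t + q + q')  ≡⟨ cong (w !_) (trans t+q+q'≡M (sym i+q≡M)) ⟩
      w ! (i + q)       ∎
    where
    open ≡-Reasoning
    i≤M : i ≤ M
    i≤M = ≤-trans (m≤m+n i q) (≤-reflexive i+q≡M)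
    q'≤i : q' ≤ i
    q'≤i = +-cancelʳ-≤ q q' i (≤-trans (≤-reflexive (+-comm q' q))
                                        (≤-trans q+q'≤M (≤-reflexive (sym i+q≡M))))
    t : ℕ
    t = i ∸ q'
    t+q'≡i : t + q' ≡ i
    t+q'≡i = m∸n+n≡m q'≤i
    t+q+q'≡M : t + q + q' ≡ M
    t+q+q'≡M = trans (+-shuffle t q q')
                 (trans (sym (+-assoc t q' q)) (trans (cong (_+ q) t+q'≡i) i+q≡M))
    t+q<M : t + q < M
    t+q<M = <-≤-trans (m<m+n (t + q) 1≤q') (≤-reflexive t+q+q'≡M)

  break-unique : ∀ {q q' M M'} → Break q M → Break q' M' → q + q' ≤ M → q + q' ≤ M'
               → M ≡ M'
  break-unique {q} {q'} {M} {M'} b@(per , ¬per) b'@(per' , ¬per') h h' with <-cmp M M'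
  ... | tri< M<M' _ _ =
    ⊥-elim (¬per (period-extend per (period-mono M<M' per') (break-positive b') h))
  ... | tri≈ _ M≡M' _ = M≡M'
  ... | tri> _ _ M'<M =
    ⊥-elim (¬per' (period-extend per' (period-mono M'<M per) (break-positive b)
                                      (subst (_≤ M') (+-comm q q') h')))

  period-difference : ∀ {p q J₁ J₂ M} → Period p J₁ → Period (p + q) J₂
                    → M + p ≤ J₁ → M + p ≤ J₂ → Period q M
  period-difference {p} {q} {J₂ = J₂} {M} per₁ per₂ h₁ h₂ i i+q<M = begin
      w ! i             ≡⟨ per₂ i (subst (_≤ J₂) (+-shuffle (suc i) q p) (≤-trans i+q+p<M+p h₂)) ⟩
      w ! (i + (p + q)) ≡⟨ cong (w !_) (sym (+-shuffle i q p)) ⟩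
      w ! (i + q + p)   ≡⟨ sym (per₁ (i + q) (≤-trans i+q+p<M+p h₁)) ⟩
      w ! (i + q)       ∎
    where
    open ≡-Reasoning
    i+q+p<M+p : i + q + p < M + p
    i+q+p<M+p = +-monoˡ-< p i+q<M

module Occurrences {A : Set} (w : List A) where
  open Periodicity w

  border-period : ∀ {j} {u : List A} → j ≤ length w → IsBorder u (pre w j)
                → Σ ℕ λ p → j ≡ length u + p × Period p j
  border-period {j} {u} j≤n ((t , u++t≡pre) , (r , r++u≡pre)) = length r , j≡u+r , per
    where
    j≡u+r : j ≡ length u + length r
    j≡u+r = begin
      j                       ≡⟨ sym (trans (length-take j w) (m≤n⇒m⊓n≡m j≤n)) ⟩
      length (take j w)       ≡⟨ cong length (sym r++u≡pre) ⟩
      length (r ++ u)         ≡⟨ length-++ r ⟩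
      length r + length u     ≡⟨ +-comm (length r) (length u) ⟩
      length u + length r     ∎
      where open ≡-Reasoning
    per : Period (length r) j
    per i i+r<j = begin
      w ! i                     ≡⟨ sym (!-take w j i (≤-trans (s≤s (m≤m+n i _)) i+r<j)) ⟩
      take j w ! i              ≡⟨ cong (_! i) (sym u++t≡pre) ⟩
      (u ++ t) ! i              ≡⟨ !-++ˡ u t i i<u ⟩
      u ! i                     ≡⟨ sym (!-++ʳ r u i) ⟩
      (r ++ u) ! (length r + i) ≡⟨ cong (_! (length r + i)) r++u≡pre ⟩
      take j w ! (length r + i) ≡⟨ !-take w j _ (subst (_< j) (+-comm i (length r)) i+r<j) ⟩
      w ! (length r + i)        ≡⟨ cong (w !_) (+-comm (length r) i) ⟩
      w ! (i + length r)        ∎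
      where
      open ≡-Reasoning
      i<u : i < length u
      i<u = +-cancelʳ-< (length r) i (length u) (subst (i + length r <_) j≡u+r i+r<j)

  -- The data of π'_w[v + p] = v: p is a period of w[0 .. v + p), and the letter after
  -- the border differs from the letter after the prefix (when there is one).
  record Occurrence (v p : ℕ) : Set where
    field
      periodic : Period p (v + p)
      within   : v + p ≤ length w
      strong   : v + p < length w → w ! v ≢ w ! (v + p)
  open Occurrence public

  occurrence : ∀ {j v} → StrongFail w j (ℤ.+ v) → Σ ℕ λ p → j ≡ v + p × Occurrence v p
  occurrence (last u j≡n (border , _) _) with border-period (≤-reflexive j≡n) border
  ... | p , refl , per = p , refl , record
    { periodic = per ; within = ≤-reflexive j≡n ; strong = λ j<n → ⊥-elim (<-irrefl j≡n j<n) }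
  occurrence (inner u _ j<n ((border , _) , letters≢) _) with border-period (<⇒≤ j<n) border
  ... | p , refl , per = p , refl , record
    { periodic = per ; within = <⇒≤ j<n ; strong = λ _ → letters≢ }

  strongFail-functional : ∀ {j v v'} → StrongFail w j (ℤ.+ v) → StrongFail w j (ℤ.+ v')
                        → v ≡ v'
  strongFail-functional (last u _ b max) (last u' _ b' max') = ≤-antisym (max' u b) (max u' b')
  strongFail-functional (last _ j≡n _ _) (inner _ _ j<n _ _) = ⊥-elim (<-irrefl j≡n j<n)
  strongFail-functional (inner _ _ j<n _ _) (last _ j≡n _ _) = ⊥-elim (<-irrefl j≡n j<n)
  strongFail-functional (inner u _ _ b max) (inner u' _ _ b' max') = ≤-antisym (max' u b) (max u' b')

  -- For occurrences (va, pa) and (vb, pa + q) ending at ja = va + pa < jb, the period q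
  -- breaks at va:  w[va − q] = w[ja] ≠ w[va].
  break-before : ∀ {va pa vb q} → Occurrence va pa → Occurrence vb (pa + q)
               → va + pa < vb + (pa + q) → q ≤ va → ¬ Period q (suc va)
  break-before {va} {pa} {vb} {q} a b ja<jb q≤va per =
    strong a (<-≤-trans ja<jb (within b)) (begin
      w ! va            ≡⟨ cong (w !_) (sym t+q≡va) ⟩
      w ! (t + q)       ≡⟨ sym (per t (s≤s (≤-reflexive t+q≡va))) ⟩
      w ! t             ≡⟨ periodic b t (subst (_< vb + (pa + q)) (sym t+pb≡ja) ja<jb) ⟩
      w ! (t + (pa + q)) ≡⟨ cong (w !_) t+pb≡ja ⟩
      w ! (va + pa)     ∎)
    where
    open ≡-Reasoning
    t : ℕ
    t = va ∸ q
    t+q≡va : t + q ≡ va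
    t+q≡va = m∸n+n≡m q≤va
    t+pb≡ja : t + (pa + q) ≡ va + pa
    t+pb≡ja = trans (sym (+-shuffle t q pa)) (cong (_+ pa) t+q≡va)

  -- Symmetrically, when jb < ja the period q breaks at vb + q:  w[vb + q] = w[jb] ≠ w[vb].
  break-after : ∀ {va pa vb q} → Occurrence va pa → Occurrence vb (pa + q)
              → vb + (pa + q) < va + pa → ¬ Period q (suc (vb + q))
  break-after {va} {pa} {vb} {q} a b jb<ja per =
    strong b (<-≤-trans jb<ja (within a)) (begin
      w ! vb             ≡⟨ per vb ≤-refl ⟩
      w ! (vb + q)       ≡⟨ periodic a (vb + q) (subst (_< va + pa) (sym (+-shuffle vb q pa)) jb<ja) ⟩
      w ! (vb + q + pa)  ≡⟨ cong (w !_) (+-shuffle vb q pa) ⟩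
      w ! (vb + (pa + q)) ∎)
    where open ≡-Reasoning

  common-break : ∀ {va pa vb q} → Occurrence va pa → Occurrence vb (pa + q)
               → va + pa ≢ vb + (pa + q) → pa + q ≤ va + pa
               → Σ ℕ λ M → Break q M × va ⊓ vb ≤ M × M + pa ≡ (va + pa) ⊓ (vb + (pa + q))
  common-break {va} {pa} {vb} {q} a b ja≢jb pb≤ja with <-cmp (va + pa) (vb + (pa + q))
  ... | tri≈ _ ja≡jb _ = ⊥-elim (ja≢jb ja≡jb)
  ... | tri< ja<jb _ _ =
    va , (per , break-before a b ja<jb q≤va) , m⊓n≤m va vb , sym (m≤n⇒m⊓n≡m (<⇒≤ ja<jb))
    where
    q≤va : q ≤ va
    q≤va = +-cancelˡ-≤ pa q va (subst (pa + q ≤_) (+-comm va pa) pb≤ja)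
    per : Period q va
    per = period-difference (periodic a) (periodic b) ≤-refl (<⇒≤ ja<jb)
  ... | tri> _ _ jb<ja =
    vb + q , (per , break-after a b jb<ja) , ≤-trans (m⊓n≤n va vb) (m≤m+n vb q) ,
    trans (+-shuffle vb q pa) (sym (m≥n⇒m⊓n≡n (<⇒≤ jb<ja)))
    where
    per : Period q (vb + q)
    per = period-difference (periodic a) (periodic b)
            (subst (_≤ va + pa) (sym (+-shuffle vb q pa)) (<⇒≤ jb<ja))
            (≤-reflexive (+-shuffle vb q pa))

AllPairs-resp-⊆ : {X : Set} {R : X → X → Set} {xs ys : List X}
                → ys ⊆ xs → AllPairs R xs → AllPairs R ys
AllPairs-resp-⊆ []          []          = []
AllPairs-resp-⊆ (_ ∷ʳ ys⊆xs) (_ ∷ rxs)  = AllPairs-resp-⊆ ys⊆xs rxs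
AllPairs-resp-⊆ (refl ∷ ys⊆xs) (rx ∷ rxs) = All-resp-⊆ ys⊆xs rx ∷ AllPairs-resp-⊆ ys⊆xs rxs

length-filter-split : {X : Set} {P : X → Set} (P? : Decidable P) (xs : List X)
                    → length xs ≡ length (filter P? xs) + length (filter (∁? P?) xs)
length-filter-split P? []       = refl
length-filter-split P? (x ∷ xs) with P? x
... | yes _ = cong suc (length-filter-split P? xs)
... | no  _ = trans (cong suc (length-filter-split P? xs)) (sym (+-suc _ _))

count-by-key : {X : Set} (key : X → ℕ) (C K : ℕ) (xs : List X)
             → All (λ x → key x < K) xs
             → (∀ c ys → ys ⊆ xs → All (λ y → key y ≡ c) ys → length ys ≤ C)
             → length xs ≤ K * C
count-by-key key C zero    []       _         _      = z≤n
count-by-key key C zero    (_ ∷ _)  (() ∷ _)  _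
count-by-key key C (suc K) xs       keys<1+K  fibres = begin
    length xs                           ≡⟨ length-filter-split top? xs ⟩
    length (filter top? xs) + length rest
      ≤⟨ +-mono-≤ (fibres K _ (filter-⊆ top? xs) (all-filter top? xs))
                  (count-by-key key C K rest keys<K rest-fibres) ⟩
    C + K * C                           ∎
  where
  open ≤-Reasoning
  top? : Decidable (λ x → key x ≡ K)
  top? x = key x ≟ K
  rest : List _
  rest = filter (∁? top?) xs
  keys<K : All (λ x → key x < K) rest
  keys<K = All.zipWith (λ (k<1+K , k≢K) → ≤∧≢⇒< (≤-pred k<1+K) k≢K)
                       (filter⁺ (∁? top?) keys<1+K , all-filter (∁? top?) xs)
  rest-fibres : ∀ c ys → ys ⊆ rest → All (λ y → key y ≡ c) ys → length ys ≤ C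
  rest-fibres c ys ys⊆rest = fibres c ys (⊆-trans ys⊆rest (filter-⊆ (∁? top?) xs))

same-quotient : ∀ L .{{_ : NonZero L}} a b → a / L ≡ b / L → a < b + L
same-quotient L a b a/L≡b/L = begin-strict
    a                     ≡⟨ m≡m%n+[m/n]*n a L ⟩
    a % L + (a / L) * L   <⟨ +-monoˡ-< _ (m%n<n a L) ⟩
    L + (a / L) * L       ≡⟨ cong (λ z → L + z * L) a/L≡b/L ⟩
    L + (b / L) * L       ≤⟨ +-monoʳ-≤ L (m/n*n≤m b L) ⟩
    L + b                 ≡⟨ +-comm L b ⟩
    b + L                 ∎
  where open ≤-Reasoning

quarter : (L : ℕ) .{{_ : NonZero L}} → ℕ → ℕ → ℕ
quarter L base x = ((x ∸ base) * 4) / L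

quarter-bound : ∀ L .{{_ : NonZero L}} {base x} → x < base + L → quarter L base x < 4
quarter-bound L {base} {x} x<base+L =
  m<n*o⇒m/o<n (subst ((x ∸ base) * 4 <_) (*-comm L 4)
                     (*-monoˡ-< 4 (m<n+o⇒m∸n<o x base x<base+L)))

quarter-near : ∀ L .{{_ : NonZero L}} {base x y} → base ≤ x → base ≤ y
             → quarter L base x ≡ quarter L base y → 4 * x < 4 * y + L
quarter-near L {base} {x} {y} base≤x base≤y same = begin-strict
    4 * x                              ≡⟨ cong (4 *_) (sym (m∸n+n≡m base≤x)) ⟩
    4 * (x ∸ base + base)              ≡⟨ expand (x ∸ base) base ⟩
    (x ∸ base) * 4 + base * 4          <⟨ +-monoˡ-< (base * 4) (same-quotient L _ _ same) ⟩
    (y ∸ base) * 4 + L + base * 4      ≡⟨ collect (y ∸ base) L base ⟩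
    4 * (y ∸ base + base) + L          ≡⟨ cong (λ z → 4 * z + L) (m∸n+n≡m base≤y) ⟩
    4 * y + L                          ∎
  where
  open ≤-Reasoning
  expand : ∀ a b → 4 * (a + b) ≡ a * 4 + b * 4
  expand = solve-∀
  collect : ∀ a l b → a * 4 + l + b * 4 ≡ 4 * (a + b) + l
  collect = solve-∀

short-difference : ∀ L va pa vb q → 4 * (vb + (pa + q)) < 4 * (va + pa) + L
                 → 4 * va < 4 * vb + L → 2 * q < L
short-difference L va pa vb q jb≈ja va≈vb =
  *-cancelˡ-≤ 2 (+-cancelˡ-≤ (4 * va + 4 * pa + 4 * vb) _ _
    (subst₂ _≤_ (lhs va pa vb q) (rhs va pa vb L) (+-mono-≤ jb≈ja va≈vb)))
  where
  lhs : ∀ va pa vb q → suc (4 * (vb + (pa + q))) + suc (4 * va)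
                     ≡ (4 * va + 4 * pa + 4 * vb) + 2 * suc (2 * q)
  lhs = solve-∀
  rhs : ∀ va pa vb L → (4 * (va + pa) + L) + (4 * vb + L) ≡ (4 * va + 4 * pa + 4 * vb) + 2 * L
  rhs = solve-∀

2^[k+1]≡2^k+2^k : ∀ k → 2 ^ (k + 1) ≡ 2 ^ k + 2 ^ k
2^[k+1]≡2^k+2^k k = trans (cong (2 ^_) (+-comm k 1)) (cong ((2 ^ k) +_) (+-identityʳ (2 ^ k)))

short-sum : ∀ {L q q'} → 2 * q < L → 2 * q' < L → q + q' ≤ L
short-sum {L} {q} {q'} 2q<L 2q'<L = *-cancelˡ-≤ 2 (begin
    2 * (q + q')     ≡⟨ *-distribˡ-+ 2 q q' ⟩
    2 * q + 2 * q'   ≤⟨ +-mono-≤ (<⇒≤ 2q<L) (<⇒≤ 2q'<L) ⟩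
    L + L            ≡⟨ cong (L +_) (sym (+-identityʳ L)) ⟩
    2 * L            ∎)
  where open ≤-Reasoning

common-minimum : ∀ {R p v j₁ j₂} → R + p ≡ (v + p) ⊓ j₁ → R + p ≡ (v + p) ⊓ j₂ → j₁ ≢ j₂
               → v ≡ R
common-minimum {R} {p} {v} {j₁} {j₂} e₁ e₂ j₁≢j₂ with ≤-total (v + p) j₁ | ≤-total (v + p) j₂
... | inj₁ le | _ = sym (+-cancelʳ-≡ p R v (trans e₁ (m≤n⇒m⊓n≡m le)))
... | inj₂ _ | inj₁ le = sym (+-cancelʳ-≡ p R v (trans e₂ (m≤n⇒m⊓n≡m le)))
... | inj₂ ge₁ | inj₂ ge₂ =
  ⊥-elim (j₁≢j₂ (trans (sym (trans e₁ (m≥n⇒m⊓n≡n ge₁))) (trans e₂ (m≥n⇒m⊓n≡n ge₂))))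

module Segment {A : Set} (w : List A) (L s : ℕ) .{{_ : NonZero L}} where
  open Periodicity w
  open Occurrences w

  record Point : Set where
    field
      v p    : ℕ
      value  : StrongFail w (v + p) (ℤ.+ v)
      occ    : Occurrence v p
      v-low  : L ≤ v
      v-high : v < L + L
      j-low  : s ≤ v + p
      j-high : v + p < s + L
  open Point

  j : Point → ℕ
  j a = v a + p a

  distinct-positions : ∀ a b → v a ≢ v b → j a ≢ j b
  distinct-positions a b va≢vb ja≡jb =
    va≢vb (strongFail-functional (value a) (subst (λ i → StrongFail w i (ℤ.+ v b)) (sym ja≡jb) (value b)))

  cell-j cell-v : Point → ℕ
  cell-j a = quarter L s (j a)
  cell-v a = quarter L L (v a)

  InCell : ℕ → ℕ → Point → Set
  InCell c c' a = cell-j a ≡ c × cell-v a ≡ c'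

  record Near (a b : Point) : Set where
    field
      j-near : 4 * j b < 4 * j a + L
      v-near : 4 * v a < 4 * v b + L

  near : ∀ {c c'} a b → InCell c c' a → InCell c c' b → Near a b
  near a b (ja∈c , va∈c') (jb∈c , vb∈c') = record
    { j-near = quarter-near L (j-low b) (j-low a) (trans jb∈c (sym ja∈c))
    ; v-near = quarter-near L (v-low a) (v-low b) (trans va∈c' (sym vb∈c')) }

  record SharedBreak (a b : Point) : Set where
    field
      q M        : ℕ
      break      : Break q M
      q-short    : 2 * q < L
      M-long     : L ≤ M
      M-position : M + (p a ⊓ p b) ≡ j a ⊓ j b

  shared-break-sym : ∀ {a b} → SharedBreak a b → SharedBreak b a
  shared-break-sym {a} {b} sb = record
    { q = q ; M = M ; break = break ; q-short = q-short ; M-long = M-long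
    ; M-position = trans (cong (M +_) (⊓-comm (p b) (p a))) (trans M-position (⊓-comm (j a) (j b))) }
    where open SharedBreak sb

  shared-break-ordered : ∀ a b → p a ≤ p b → v a ≢ v b → Near a b → SharedBreak a b
  shared-break-ordered a b pa≤pb va≢vb ab =
    from-common (common-break (occ a) (subst (Occurrence (v b)) (sym pa+q≡pb) (occ b))
                              (subst (j a ≢_) (sym jb≡) (distinct-positions a b va≢vb))
                              (subst (_≤ j a) (sym pa+q≡pb) (<⇒≤ pb<ja)))
    where
    q : ℕ
    q = p b ∸ p a
    pa+q≡pb : p a + q ≡ p b
    pa+q≡pb = m+[n∸m]≡n pa≤pb
    jb≡ : v b + (p a + q) ≡ j b
    jb≡ = cong (v b +_) pa+q≡pb
    pb<ja : p b < j a
    pb<ja = +-cancelˡ-< (v b) (p b) (j a) (begin-strict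
      v b + p b   <⟨ j-high b ⟩
      s + L       ≤⟨ +-mono-≤ (j-low a) (v-low b) ⟩
      j a + v b   ≡⟨ +-comm (j a) (v b) ⟩
      v b + j a   ∎)
      where open ≤-Reasoning
    from-common : (Σ ℕ λ M → Break q M × v a ⊓ v b ≤ M × M + p a ≡ j a ⊓ (v b + (p a + q)))
                → SharedBreak a b
    from-common (M , brk , va⊓vb≤M , position) = record
      { q = q ; M = M ; break = brk
      ; q-short = short-difference L (v a) (p a) (v b) q
                    (subst (λ i → 4 * i < 4 * j a + L) (sym jb≡) (Near.j-near ab)) (Near.v-near ab)
      ; M-long = ≤-trans (⊓-glb (v-low a) (v-low b)) va⊓vb≤M
      ; M-position = trans (cong (M +_) (m≤n⇒m⊓n≡m pa≤pb)) (trans position (cong (j a ⊓_) jb≡)) }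

  shared-break : ∀ {c c'} a b → v a ≢ v b → InCell c c' a → InCell c c' b → SharedBreak a b
  shared-break a b va≢vb a∈ b∈ with ≤-total (p a) (p b)
  ... | inj₁ pa≤pb = shared-break-ordered a b pa≤pb va≢vb (near a b a∈ b∈)
  ... | inj₂ pb≤pa = shared-break-sym (shared-break-ordered b a pb≤pa (λ e → va≢vb (sym e)) (near b a b∈ a∈))

  -- All shared breaks sit at the same position, since their periods are short.
  shared-break-position : ∀ {a b c d} (x : SharedBreak a b) (y : SharedBreak c d)
                        → SharedBreak.M x ≡ SharedBreak.M y
  shared-break-position x y = break-unique (break x) (break y)
    (≤-trans q+q'≤L (M-long x)) (≤-trans q+q'≤L (M-long y))
    where
    open SharedBreak
    q+q'≤L : q x + q y ≤ L
    q+q'≤L = short-sum {q = q x} {q' = q y} (q-short x) (q-short y)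

  Aligned : ℕ → Point → Point → Set
  Aligned R a b = R + (p a ⊓ p b) ≡ j a ⊓ j b

  aligned-sym : ∀ {R} a b → Aligned R a b → Aligned R b a
  aligned-sym {R} a b e = trans (cong (R +_) (⊓-comm (p b) (p a))) (trans e (⊓-comm (j a) (j b)))

  aligned-least : ∀ {R} a b c → p a ≤ p b → p a ≤ p c → Aligned R a b → Aligned R a c
                → j b ≢ j c → v a ≡ R
  aligned-least {R} a b c pa≤pb pa≤pc ab ac =
    common-minimum (trans (cong (R +_) (sym (m≤n⇒m⊓n≡m pa≤pb))) ab)
                   (trans (cong (R +_) (sym (m≤n⇒m⊓n≡m pa≤pc))) ac)

  aligned-triple : ∀ {R} a b c → v a ≢ v b → v a ≢ v c → v b ≢ v c
                 → Aligned R a b → Aligned R a c → Aligned R b c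
                 → v a ≡ R ⊎ v b ≡ R ⊎ v c ≡ R
  aligned-triple a b c va≢vb va≢vc vb≢vc ab ac bc with ≤-total (p a) (p b)
  ... | inj₁ pa≤pb with ≤-total (p a) (p c)
  ...   | inj₁ pa≤pc = inj₁ (aligned-least a b c pa≤pb pa≤pc ab ac (distinct-positions b c vb≢vc))
  ...   | inj₂ pc≤pa = inj₂ (inj₂ (aligned-least c a b pc≤pa (≤-trans pc≤pa pa≤pb)
                         (aligned-sym a c ac) (aligned-sym b c bc) (distinct-positions a b va≢vb)))
  aligned-triple a b c va≢vb va≢vc vb≢vc ab ac bc | inj₂ pb≤pa with ≤-total (p b) (p c)
  ...   | inj₁ pb≤pc = inj₂ (inj₁ (aligned-least b a c pb≤pa pb≤pc
                         (aligned-sym a b ab) bc (distinct-positions a c va≢vc)))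
  ...   | inj₂ pc≤pb = inj₂ (inj₂ (aligned-least c a b (≤-trans pc≤pb pb≤pa) pc≤pb
                         (aligned-sym a c ac) (aligned-sym b c bc) (distinct-positions a b va≢vb)))

  -- Four points with distinct values cannot be pairwise aligned: every triple among them
  -- contains a point of value R, which forces two values to coincide.
  no-four-aligned : ∀ {R} a b c d
    → v a ≢ v b → v a ≢ v c → v a ≢ v d → v b ≢ v c → v b ≢ v d → v c ≢ v d
    → Aligned R a b → Aligned R a c → Aligned R a d → Aligned R b c → Aligned R b d → Aligned R c d
    → ⊥
  no-four-aligned a b c d ab ac ad bc bd cd al-ab al-ac al-ad al-bc al-bd al-cd
    with aligned-triple a b c ab ac bc al-ab al-ac al-bc
  ... | inj₁ a≡R with aligned-triple b c d bc bd cd al-bc al-bd al-cd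
  ...   | inj₁ b≡R        = ab (trans a≡R (sym b≡R))
  ...   | inj₂ (inj₁ c≡R) = ac (trans a≡R (sym c≡R))
  ...   | inj₂ (inj₂ d≡R) = ad (trans a≡R (sym d≡R))
  no-four-aligned a b c d ab ac ad bc bd cd al-ab al-ac al-ad al-bc al-bd al-cd
    | inj₂ (inj₁ b≡R) with aligned-triple a c d ac ad cd al-ac al-ad al-cd
  ...   | inj₁ a≡R        = ab (trans a≡R (sym b≡R))
  ...   | inj₂ (inj₁ c≡R) = bc (trans b≡R (sym c≡R))
  ...   | inj₂ (inj₂ d≡R) = bd (trans b≡R (sym d≡R))
  no-four-aligned a b c d ab ac ad bc bd cd al-ab al-ac al-ad al-bc al-bd al-cd
    | inj₂ (inj₂ c≡R) with aligned-triple a b d ab ad bd al-ab al-ad al-bd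
  ...   | inj₁ a≡R        = ac (trans a≡R (sym c≡R))
  ...   | inj₂ (inj₁ b≡R) = bc (trans b≡R (sym c≡R))
  ...   | inj₂ (inj₂ d≡R) = cd (trans c≡R (sym d≡R))

  aligned-in-cell : ∀ {c c' a₀ b₀} (ref : SharedBreak a₀ b₀) x y → v x ≢ v y
                  → InCell c c' x → InCell c c' y → Aligned (SharedBreak.M ref) x y
  aligned-in-cell ref x y vx≢vy x∈ y∈ =
    trans (cong (_+ (p x ⊓ p y)) (shared-break-position ref xy)) (SharedBreak.M-position xy)
    where
    xy : SharedBreak x y
    xy = shared-break x y vx≢vy x∈ y∈

  cell-bound : ∀ c c' (ys : List Point) → AllPairs (λ a b → v a ≢ v b) ys
             → All (λ y → cell-j y ≡ c) ys → All (λ y → cell-v y ≡ c') ys → length ys ≤ 3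
  cell-bound c c' []                  _ _ _ = z≤n
  cell-bound c c' (_ ∷ [])            _ _ _ = s≤s z≤n
  cell-bound c c' (_ ∷ _ ∷ [])        _ _ _ = s≤s (s≤s z≤n)
  cell-bound c c' (_ ∷ _ ∷ _ ∷ [])    _ _ _ = s≤s (s≤s (s≤s z≤n))
  cell-bound c c' (a ∷ b ∷ d ∷ e ∷ _)
    ((ab ∷ ad ∷ ae ∷ _) ∷ (bd ∷ be ∷ _) ∷ (de ∷ _) ∷ _)
    (ja ∷ jb ∷ jd ∷ je ∷ _) (va ∷ vb ∷ vd ∷ ve ∷ _) =
    ⊥-elim (no-four-aligned a b d e ab ad ae bd be de
      (aligned a b ab a∈ b∈) (aligned a d ad a∈ d∈) (aligned a e ae a∈ e∈)
      (aligned b d bd b∈ d∈) (aligned b e be b∈ e∈) (aligned d e de d∈ e∈))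
    where
    a∈ = ja , va
    b∈ = jb , vb
    d∈ = jd , vd
    e∈ = je , ve
    aligned = aligned-in-cell (shared-break a b ab a∈ b∈)

  at-most-48 : (ps : List Point) → AllPairs (λ a b → v a ≢ v b) ps → length ps ≤ 48
  at-most-48 ps distinct =
    count-by-key cell-j 12 4 ps (All.universal (λ a → quarter-bound L (j-high a)) ps)
      λ c ys ys⊆ps ys∈c →
    count-by-key cell-v 3 4 ys (All.universal (λ a → quarter-bound L (v-high a)) ys)
      λ c' zs zs⊆ys zs∈c' →
    cell-bound c c' zs (AllPairs-resp-⊆ (⊆-trans zs⊆ys ys⊆ps) distinct) (All-resp-⊆ zs⊆ys ys∈c) zs∈c'

  Realised : ℕ → Set
  Realised x = L ≤ x × x < L + L × Σ ℕ λ i → s ≤ i × i < s + L × StrongFail w i (ℤ.+ x)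

  point : ∀ x → Realised x → Σ Point λ a → v a ≡ x
  point x (L≤x , x<2L , i , s≤i , i<s+L , val) with occurrence val
  ... | p , refl , occ = record
    { v = x ; p = p ; value = val ; occ = occ
    ; v-low = L≤x ; v-high = x<2L ; j-low = s≤i ; j-high = i<s+L } , refl

  points : (vs : List ℕ) → (∀ x → x ∈ vs → Realised x) → Σ (List Point) λ ps → map v ps ≡ vs
  points []       _        = [] , refl
  points (x ∷ xs) realised with point x (realised x (here refl))
                               | points xs (λ y y∈xs → realised y (there y∈xs))
  ... | a , va≡x | ps , vps≡xs = a ∷ ps , cong₂ _∷_ va≡x vps≡xs

  realised-bound : (vs : List ℕ) → Unique vs → (∀ x → x ∈ vs → Realised x) → length vs ≤ 48
  realised-bound vs unique realised with points vs realised
  ... | ps , vps≡vs = begin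
    length vs          ≡⟨ cong length (sym vps≡vs) ⟩
    length (map v ps)  ≡⟨ length-map v ps ⟩
    length ps          ≤⟨ at-most-48 ps (map⁻ (subst Unique (sym vps≡vs) unique)) ⟩
    48                 ∎
    where open ≤-Reasoning

-- The statement writes the non-negative values of π'_w as  + v ; this constructor is only
-- brought into scope here since it clashes with sections of ℕ-addition used above.
open import Data.Integer using (+_)

lemma4 : {A : Set} (w : List A) (k s : ℕ) → 1 ≤ s → s + 2 ^ k ∸ 1 ≤ length w
       → (vs : List ℕ) → Unique vs
       → (∀ v → v ∈ vs → 2 ^ k ≤ v × v < 2 ^ (k + 1)
            × Σ ℕ λ j → s ≤ j × j < s + 2 ^ k × StrongFail w j (+ v))
       → length vs ≤ 48
-- Apply realised-bound with L = 2^k.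
lemma4 w k s _ _ vs unique in-range = realised-bound vs unique realised
  where
  open Segment w (2 ^ k) s {{m^n≢0 2 k}}
  realised : ∀ x → x ∈ vs → Realised x
  realised x x∈vs with in-range x x∈vs
  ... | low , high , position = low , subst (x <_) (2^[k+1]≡2^k+2^k k) high , position
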